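{- Let $B$ and $r$ be positive integers with $r$ even and $B/2<r\le \frac{2}{3}B$. Consider the following uneven-splitting block process, in which every block has size in $\{r/2,\,r,\,3r/2\}$. It starts with a single block of $r$ keys (total number of keys $n=r$). Whenever the total number of keys is $n$, a batch of $r$ keys is inserted into one existing block chosen at random, a block of size $s$ being chosen with probability $s/n$, with the following effect: a block of $r/2$ keys becomes a block of $3r/2$ keys (no split); a block of $r$ keys overflows and is split by TargetSplit with targets $f_L=r/2$, $f_R=3r/2$, so it is replaced by blocks of sizes $r/2$ and $3r/2$; a block of $3r/2$ keys overflows and is split by TargetSplit with targets $f_L=r$, $f_R=3r/2$, so it is replaced by blocks of sizes $r$ and $3r/2$. Let $X^n$ be the number of blocks when the total number of keys is $n$. Then $n/\mathbb{E}[X^n]\to \frac{10}{9}r$ as $n\to\infty$.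
   Context: TargetSplit$(A,k,f_L,f_R)$, for a full block $A$ with sorted keys $k_1<\dots<k_B$, a new key $k$ of an ongoing batch, and targets with $f_L+f_R>B$: let $j=|\{i:k_i<k\}|$. If $j\ge f_L$, split $A$ into $A_L=k_1,\dots,k_{f_L}$ and $A_R=k_{f_L+1},\dots,k_B$, and insert $k$ and the next $f_L+f_R-B-1$ keys of the batch into $A_R$. Else if $j\le B-f_R$, split into $A_L=k_1,\dots,k_{B-f_R}$ and $A_R=k_{B-f_R+1},\dots,k_B$ and insert $k$ and the next $f_L+f_R-B-1$ keys into $A_L$. Otherwise split into $A_L=k_1,\dots,k_j$, $A_R=k_{j+1},\dots,k_B$, insert $k$ and the next $f_L-j-1$ keys into $A_L$, then the next $f_R+j-B$ keys into $A_R$. The average block size is the total number of keys divided by the number of blocks. -}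

module Defs where

open import Data.Nat as ℕ using (ℕ; zero; suc; _∸_)
open import Data.Integer using (+_)
open import Data.Rational as ℚ using (ℚ; 0ℚ; _÷_; ≢-nonZero)
open import Data.Rational.Properties using (_≟_)
open import Data.List using (List; []; _∷_; _++_; concatMap; foldr)
open import Data.Product using (_×_; _,_)
open import Relation.Nullary using (yes; no)

⟦_⟧ : ℕ → ℚ
⟦ n ⟧ = (+ n) ℚ./ 1

-- Configuration of the process: (a , b , c) =
--   a = number of blocks of size r/2,
--   b = number of blocks of size r,
--   c = number of blocks of size 3r/2.
Config : Set
Config = ℕ × ℕ × ℕ

-- total number of keys of a configuration (r is even, so r / 2 is exact)
keys : ℕ → Config → ℕ
keys r (a , b , c) =
  ℕ._+_ (ℕ._+_ (ℕ._*_ a (r ℕ./ 2)) (ℕ._*_ b r)) (ℕ._*_ c (ℕ._*_ 3 (r ℕ./ 2)))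

blocks : Config → ℕ
blocks (a , b , c) = ℕ._+_ (ℕ._+_ a b) c

-- total division on ℚ (x / 0 := 0; never used at 0 in the theorem)
_⊘_ : ℚ → ℚ → ℚ
p ⊘ q with q ≟ 0ℚ
... | yes _ = 0ℚ
... | no q≢0 = _÷_ p q {{≢-nonZero q≢0}}

Dist : Set
Dist = List (ℚ × Config)

-- A block of size s is chosen with probability s/n, so the type
-- "size r/2" is chosen with prob. a(r/2)/n, etc.
--  * size r/2 block  -> becomes size 3r/2 (no split)
--  * size r   block  -> split into blocks of sizes r/2 and 3r/2
--  * size 3r/2 block -> split into blocks of sizes r and 3r/2
-- (branches with zero probability are harmless: they carry weight 0)
stepConfig : ℕ → ℚ × Config → Dist
stepConfig r (p , (a , b , c)) =
    (p ℚ.* (⟦ ℕ._*_ a (r ℕ./ 2) ⟧ ⊘ n) , (a ∸ 1 , b , suc c))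
  ∷ (p ℚ.* (⟦ ℕ._*_ b r ⟧ ⊘ n) , (suc a , b ∸ 1 , suc c))
  ∷ (p ℚ.* (⟦ ℕ._*_ c (ℕ._*_ 3 (r ℕ./ 2)) ⟧ ⊘ n) , (a , suc b , c))
  ∷ []
  where
  n : ℚ
  n = ⟦ keys r (a , b , c) ⟧

step : ℕ → Dist → Dist
step r = concatMap (stepConfig r)

distAfter : ℕ → ℕ → Dist
distAfter r zero = (ℚ.1ℚ , (0 , 1 , 0)) ∷ []
distAfter r (suc k) = step r (distAfter r k)

keysAfter : ℕ → ℕ → ℕ
keysAfter r k = ℕ._*_ (suc k) r

expectedBlocks : ℕ → ℕ → ℚ
expectedBlocks r k =
  foldr (λ { (p , cfg) acc → p ℚ.* ⟦ blocks cfg ⟧ ℚ.+ acc }) 0ℚ (distAfter r k)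

-- Write a configuration as counts (a , b , c) of blocks of sizes r/2, r, 3r/2, and let n = (k + 1) r
-- be the number of keys after k batches. For a linear function L = x a + y b + z c of the counts,
-- one batch changes the expectation of L by (r/2)/n times the expectation of the linear function
-- with coefficients drift (x , y , z). The drift map has eigenvalues 2, -2, -3 with eigenvectors
-- ψ₂ = (1,2,3), ψ₋₂ = (3,2,-3), ψ₋₃ = (1,2,-2), so each of these moments is multiplied by
-- 1 + e/(2(k + 1)) per batch. Hence the ψ₂-moment (the size in units of r/2) is 2(k + 1), the
-- ψ₋₂-moment vanishes after the first batch, and minus the ψ₋₃-moment equals 1 after the first batch
-- and is then multiplied by factors in [0,1]. Since the block count is 9/20 ψ₂ + 1/4 ψ₋₂ - 1/5 ψ₋₃,
-- after k + 1 batches E[X] = 9/10 (k + 2) + g/5 with g ∈ [0,1], and n / E[X] is within r/(k + 2)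
-- of 10 r / 9.

{-# OPTIONS --safe #-}
module Submission where

open import Defs
open import Data.Nat as ℕ using (ℕ; zero; suc; _∸_)
open import Data.Nat.Divisibility using (_∣_)
open import Data.Integer as ℤ using (+_)
open import Data.Rational as ℚ using (ℚ; 0ℚ; 1ℚ; mkℚ; ∣_∣; _+_; _*_; -_; _-_; 1/_; _≤_; _<_)
open import Data.Product using (Σ; _×_; _,_; ∃-syntax)
open import Data.Sum using (_⊎_; inj₁; inj₂)
open import Data.List using ([]; _∷_; _++_; foldr)
open import Data.List.Relation.Unary.All as All using (All; []; _∷_)
open import Data.List.Relation.Unary.All.Properties using (concat⁺; map⁺)
open import Data.Empty using (⊥-elim)
open import Level using (0ℓ)
open import Relation.Binary.PropositionalEquality
open import Relation.Nullary using (yes; no)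
open import Relation.Nullary.Decidable using (dec⇒maybe)
open import Tactic.RingSolver using (solve-∀)
open import Tactic.RingSolver.Core.AlmostCommutativeRing using (AlmostCommutativeRing; fromCommutativeRing)
import Data.Nat.Coprimality as Coprimality
import Data.Nat.DivMod as ℕ
import Data.Nat.Properties as ℕ
import Data.Nat.Tactic.RingSolver as ℕ-Solver
import Data.Integer.Properties as ℤ
import Data.Rational.Properties as ℚ

ℚ-ring : AlmostCommutativeRing 0ℓ 0ℓ
ℚ-ring = fromCommutativeRing ℚ.+-*-commutativeRing (λ p → dec⇒maybe (0ℚ ℚ.≟ p))

⟦⟧≡mkℚ : ∀ n → ⟦ n ⟧ ≡ mkℚ (+ n) 0 (Coprimality.sym (Coprimality.1-coprimeTo n))
⟦⟧≡mkℚ n = ℚ.normalize-coprime _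

⟦⟧-homo-+ : ∀ m n → ⟦ m ℕ.+ n ⟧ ≡ ⟦ m ⟧ + ⟦ n ⟧
⟦⟧-homo-+ m n rewrite ⟦⟧≡mkℚ m | ⟦⟧≡mkℚ n =
  cong (ℚ._/ 1) (trans (ℤ.pos-+ m n) (sym (cong₂ ℤ._+_ (ℤ.*-identityʳ (+ m)) (ℤ.*-identityʳ (+ n)))))

⟦⟧-homo-* : ∀ m n → ⟦ m ℕ.* n ⟧ ≡ ⟦ m ⟧ * ⟦ n ⟧
⟦⟧-homo-* m n rewrite ⟦⟧≡mkℚ m | ⟦⟧≡mkℚ n = cong (ℚ._/ 1) (ℤ.pos-* m n)

⟦⟧-suc : ∀ n → ⟦ suc n ⟧ ≡ 1ℚ + ⟦ n ⟧
⟦⟧-suc = ⟦⟧-homo-+ 1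

⟦⟧-nonNeg : ∀ n → 0ℚ ≤ ⟦ n ⟧
⟦⟧-nonNeg n = ℚ.nonNegative⁻¹ ⟦ n ⟧ {{ℚ.normalize-nonNeg n 1}}

⟦⟧-pos : ∀ n .{{_ : ℕ.NonZero n}} → 0ℚ < ⟦ n ⟧
⟦⟧-pos (suc n) = ℚ.positive⁻¹ ⟦ suc n ⟧ {{ℚ.normalize-pos (suc n) 1}}

⟦⟧-mono-< : ∀ {m n} → m ℕ.< n → ⟦ m ⟧ < ⟦ n ⟧
⟦⟧-mono-< {m} {n} m<n rewrite ⟦⟧≡mkℚ m | ⟦⟧≡mkℚ n = ℚ.*<* (ℤ.*-monoʳ-<-pos (+ 1) (ℤ.+<+ m<n))

*-nonNeg : ∀ {p q} → 0ℚ ≤ p → 0ℚ ≤ q → 0ℚ ≤ p * q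
*-nonNeg {p} {q} 0≤p 0≤q =
  ℚ.nonNegative⁻¹ (p * q) {{ℚ.nonNeg*nonNeg⇒nonNeg p {{ℚ.nonNegative 0≤p}} q {{ℚ.nonNegative 0≤q}}}}

*-pos : ∀ {p q} → 0ℚ < p → 0ℚ < q → 0ℚ < p * q
*-pos {p} {q} 0<p 0<q = ℚ.positive⁻¹ (p * q) {{ℚ.pos*pos⇒pos p {{ℚ.positive 0<p}} q {{ℚ.positive 0<q}}}}

+-nonNeg : ∀ {p q} → 0ℚ ≤ p → 0ℚ ≤ q → 0ℚ ≤ p + q
+-nonNeg = ℚ.+-mono-≤

+-pos : ∀ {p q} → 0ℚ < p → 0ℚ ≤ q → 0ℚ < p + q
+-pos = ℚ.+-mono-<-≤

≤-+-nonNeg : ∀ {p q} d → 0ℚ ≤ d → q ≡ p + d → p ≤ q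
≤-+-nonNeg {p} d 0≤d refl = subst (_≤ p + d) (ℚ.+-identityʳ p) (ℚ.+-monoʳ-≤ p 0≤d)

0⊘ : ∀ q → 0ℚ ⊘ q ≡ 0ℚ
0⊘ q with q ℚ.≟ 0ℚ
... | yes _ = refl
... | no q≢0 = ℚ.*-zeroˡ ((1/ q) {{ℚ.≢-nonZero q≢0}})

⊘-≢0 : ∀ p {q} (q≢0 : q ≢ 0ℚ) → p ⊘ q ≡ p * (1/ q) {{ℚ.≢-nonZero q≢0}}
⊘-≢0 p {q} q≢0 with q ℚ.≟ 0ℚ
... | yes q≡0 = ⊥-elim (q≢0 q≡0)
... | no _ = refl

*-⊘-assoc : ∀ p q s → (p * q) ⊘ s ≡ p * (q ⊘ s)
*-⊘-assoc p q s with s ℚ.≟ 0ℚ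
... | yes _ = sym (ℚ.*-zeroʳ p)
... | no s≢0 = ℚ.*-assoc p q _

⊘-self : ∀ {q} → q ≢ 0ℚ → q ⊘ q ≡ 1ℚ
⊘-self {q} q≢0 = trans (⊘-≢0 q q≢0) (ℚ.*-inverseʳ q {{ℚ.≢-nonZero q≢0}})

⊘-*-cancel : ∀ p {q} → q ≢ 0ℚ → (p ⊘ q) * q ≡ p
⊘-*-cancel p {q} q≢0 = begin
  (p ⊘ q) * q         ≡⟨ cong (_* q) (⊘-≢0 p q≢0) ⟩
  p * 1/q * q         ≡⟨ ℚ.*-assoc p 1/q q ⟩
  p * (1/q * q)       ≡⟨ cong (p *_) (ℚ.*-inverseˡ q {{ℚ.≢-nonZero q≢0}}) ⟩
  p * 1ℚ              ≡⟨ ℚ.*-identityʳ p ⟩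
  p                   ∎
  where
  open ≡-Reasoning
  1/q = (1/ q) {{ℚ.≢-nonZero q≢0}}

⊘-nonNeg : ∀ {p q} → 0ℚ ≤ p → 0ℚ < q → 0ℚ ≤ p ⊘ q
⊘-nonNeg {p} {q} 0≤p 0<q = subst (0ℚ ≤_) (sym (⊘-≢0 p q≢0)) (*-nonNeg 0≤p (ℚ.<⇒≤ 0<1/q))
  where
  q≢0 = ≢-sym (ℚ.<⇒≢ 0<q)
  0<1/q = ℚ.positive⁻¹ _ {{ℚ.1/pos⇒pos q {{ℚ.positive 0<q}}}}

0*p≡0*q : ∀ p q → 0ℚ * p ≡ 0ℚ * q
0*p≡0*q p q = trans (ℚ.*-zeroˡ p) (sym (ℚ.*-zeroˡ q))

InUnitInterval : ℚ → Set
InUnitInterval p = 0ℚ ≤ p × 0ℚ ≤ 1ℚ - p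

*-unitInterval : ∀ {p q} → InUnitInterval p → InUnitInterval q → InUnitInterval (p * q)
*-unitInterval {p} {q} (0≤p , 0≤1-p) (0≤q , 0≤1-q) =
  *-nonNeg 0≤p 0≤q ,
  subst (0ℚ ≤_) (split p q) (+-nonNeg 0≤1-p (*-nonNeg 0≤p 0≤1-q))
  where
  split : ∀ p q → (1ℚ - p) + p * (1ℚ - q) ≡ 1ℚ - p * q
  split = solve-∀ ℚ-ring

archimedean : ∀ n ε → 0ℚ < ε → ∃[ N ] (∀ {m} → N ℕ.< m → ⟦ n ⟧ < ε * ⟦ m ⟧)
archimedean n ε@(mkℚ (+ suc a) b _) 0<ε = n ℕ.* suc b , λ {m} N<m → begin-strict
    ⟦ n ⟧                         ≡⟨ ℚ.*-identityʳ ⟦ n ⟧ ⟨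
    ⟦ n ⟧ * 1ℚ                    ≤⟨ ℚ.*-monoˡ-≤-nonNeg ⟦ n ⟧ {{ℚ.nonNegative (⟦⟧-nonNeg n)}} 1≤ε*[1+b] ⟩
    ⟦ n ⟧ * (ε * ⟦ suc b ⟧)       ≡⟨ regroup ⟦ n ⟧ ε ⟦ suc b ⟧ ⟩
    ε * (⟦ n ⟧ * ⟦ suc b ⟧)       ≡⟨ cong (ε *_) (⟦⟧-homo-* n (suc b)) ⟨
    ε * ⟦ n ℕ.* suc b ⟧           <⟨ ℚ.*-monoʳ-<-pos ε {{ℚ.positive 0<ε}} (⟦⟧-mono-< N<m) ⟩
    ε * ⟦ m ⟧                     ∎
  where
  open ℚ.≤-Reasoning
  regroup : ∀ p q s → p * (q * s) ≡ q * (p * s)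
  regroup = solve-∀ ℚ-ring
  1/ε≤1+b : 1/ ε ≤ ⟦ suc b ⟧
  1/ε≤1+b rewrite ⟦⟧≡mkℚ (suc b) = ℚ.*≤* (ℤ.*-monoˡ-≤-nonNeg (+ suc b) (ℤ.+≤+ (ℕ.s≤s ℕ.z≤n)))
  1≤ε*[1+b] : 1ℚ ≤ ε * ⟦ suc b ⟧
  1≤ε*[1+b] = subst (_≤ ε * ⟦ suc b ⟧) (ℚ.*-inverseʳ ε) (ℚ.*-monoˡ-≤-nonNeg ε 1/ε≤1+b)
archimedean n (mkℚ (+ 0) _ _) (ℚ.*<* (ℤ.+<+ ()))
archimedean n (mkℚ ℤ.-[1+ _ ] _ _) (ℚ.*<* ())

ratio-deficit : ∀ {m R g X} → 0ℚ ≤ R → 0ℚ ≤ g → 0ℚ < X →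
                X ≡ (+ 9 ℚ./ 10) * m + (+ 1 ℚ./ 5) * g →
                ∣ (m * R) ⊘ X - (+ 10 ℚ./ 9) * R ∣ * X ≡ (+ 2 ℚ./ 9) * R * g
ratio-deficit {m} {R} {g} {X} 0≤R 0≤g 0<X refl = begin
  ∣ err ∣ * X        ≡⟨ cong (∣ err ∣ *_) (ℚ.0≤p⇒∣p∣≡p (ℚ.<⇒≤ 0<X)) ⟨
  ∣ err ∣ * ∣ X ∣    ≡⟨ ℚ.∣p*q∣≡∣p∣*∣q∣ err X ⟨
  ∣ err * X ∣        ≡⟨ cong ∣_∣ err*X ⟩
  ∣ - deficit ∣      ≡⟨ ℚ.∣-p∣≡∣p∣ deficit ⟩
  ∣ deficit ∣        ≡⟨ ℚ.0≤p⇒∣p∣≡p (*-nonNeg (*-nonNeg (ℚ.nonNegative⁻¹ _) 0≤R) 0≤g) ⟩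
  deficit            ∎
  where
  open ≡-Reasoning
  T = (+ 10 ℚ./ 9) * R
  err = (m * R) ⊘ X - T
  deficit = (+ 2 ℚ./ 9) * R * g
  distrib : ∀ p q s → (p - q) * s ≡ p * s - q * s
  distrib = solve-∀ ℚ-ring
  excess : ∀ m R g → m * R - (+ 10 ℚ./ 9) * R * ((+ 9 ℚ./ 10) * m + (+ 1 ℚ./ 5) * g) ≡ - ((+ 2 ℚ./ 9) * R * g)
  excess = solve-∀ ℚ-ring
  err*X : err * X ≡ - deficit
  err*X = begin
    ((m * R) ⊘ X - T) * X     ≡⟨ distrib ((m * R) ⊘ X) T X ⟩
    (m * R) ⊘ X * X - T * X   ≡⟨ cong (_- T * X) (⊘-*-cancel (m * R) (≢-sym (ℚ.<⇒≢ 0<X))) ⟩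
    m * R - T * X             ≡⟨ excess m R g ⟩
    - deficit                 ∎

ratio-error : ∀ {m R g X} → 0ℚ < m → 0ℚ ≤ R → InUnitInterval g →
              X ≡ (+ 9 ℚ./ 10) * m + (+ 1 ℚ./ 5) * g →
              ∣ (m * R) ⊘ X - (+ 10 ℚ./ 9) * R ∣ * m ≤ R
ratio-error {m} {R} {g} {X} 0<m 0≤R (0≤g , 0≤1-g) refl =
  ℚ.*-cancelʳ-≤-pos X {{ℚ.positive 0<X}} (begin
    ∣ err ∣ * m * X                   ≡⟨ swap ∣ err ∣ m X ⟩
    ∣ err ∣ * X * m                   ≡⟨ cong (_* m) (ratio-deficit {m} 0≤R 0≤g 0<X refl) ⟩
    (+ 2 ℚ./ 9) * R * g * m           ≤⟨ ≤-+-nonNeg slack 0≤slack (R*X-split m R g) ⟩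
    R * X                             ∎)
  where
  open ℚ.≤-Reasoning
  0<X : 0ℚ < X
  0<X = +-pos (*-pos (ℚ.positive⁻¹ _) 0<m) (*-nonNeg (ℚ.nonNegative⁻¹ _) 0≤g)
  err = (m * R) ⊘ X - (+ 10 ℚ./ 9) * R
  slack = R * ((+ 2 ℚ./ 9) * m * (1ℚ - g) + (+ 61 ℚ./ 90) * m + (+ 1 ℚ./ 5) * g)
  0≤slack : 0ℚ ≤ slack
  0≤slack = *-nonNeg 0≤R (+-nonNeg (+-nonNeg (*-nonNeg (*-nonNeg (ℚ.nonNegative⁻¹ _) (ℚ.<⇒≤ 0<m)) 0≤1-g)
                                            (*-nonNeg (ℚ.nonNegative⁻¹ _) (ℚ.<⇒≤ 0<m)))
                                  (*-nonNeg (ℚ.nonNegative⁻¹ _) 0≤g))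
  swap : ∀ p q s → p * q * s ≡ p * s * q
  swap = solve-∀ ℚ-ring
  R*X-split : ∀ m R g → R * ((+ 9 ℚ./ 10) * m + (+ 1 ℚ./ 5) * g)
              ≡ (+ 2 ℚ./ 9) * R * g * m + R * ((+ 2 ℚ./ 9) * m * (1ℚ - g) + (+ 61 ℚ./ 90) * m + (+ 1 ℚ./ 5) * g)
  R*X-split = solve-∀ ℚ-ring

ℚ³ : Set
ℚ³ = ℚ × ℚ × ℚ

_·_ : ℚ³ → ℚ³ → ℚ
(x , y , z) · (a , b , c) = x * a + y * b + z * c

_*ₗ_ : ℚ → ℚ³ → ℚ³
e *ₗ (x , y , z) = e * x , e * y , e * z

*ₗ-· : ∀ e v w → (e *ₗ v) · w ≡ e * (v · w)
*ₗ-· e (x , y , z) (a , b , c) = lemma e x y z a b c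
  where
  lemma : ∀ e x y z a b c → e * x * a + e * y * b + e * z * c ≡ e * (x * a + y * b + z * c)
  lemma = solve-∀ ℚ-ring

linear : ℚ³ → Config → ℚ
linear v (a , b , c) = v · (⟦ a ⟧ , ⟦ b ⟧ , ⟦ c ⟧)

size : Config → ℕ
size (a , b , c) = a ℕ.+ 2 ℕ.* b ℕ.+ 3 ℕ.* c

-- A batch sent to a block of size r/2, r or 3r/2 changes `linear (x , y , z)` by
-- z - x, x - y + z or y respectively, and a block is hit with probability
-- proportional to its size 1, 2 or 3 (in units of r/2).
drift : ℚ³ → ℚ³
drift (x , y , z) = z - x , ⟦ 2 ⟧ * (x - y + z) , ⟦ 3 ⟧ * y

size-weighted-moves : ∀ v a b c →
  ⟦ a ⟧ * linear v (a ∸ 1 , b , suc c) + ⟦ 2 ℕ.* b ⟧ * linear v (suc a , b ∸ 1 , suc c)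
    + ⟦ 3 ℕ.* c ⟧ * linear v (a , suc b , c)
  ≡ ⟦ size (a , b , c) ⟧ * linear v (a , b , c) + linear (drift v) (a , b , c)
size-weighted-moves v@(x , y , z) a b c = begin
  ⟦ a ⟧ * linear v (a ∸ 1 , b , suc c) + ⟦ 2 ℕ.* b ⟧ * linear v (suc a , b ∸ 1 , suc c)
    + ⟦ 3 ℕ.* c ⟧ * linear v (a , suc b , c)
    ≡⟨ cong₂ _+_ (cong₂ _+_ (small a) (medium b)) (cong (⟦ 3 ℕ.* c ⟧ *_) large) ⟩
  ⟦ a ⟧ * (L + (z - x)) + ⟦ 2 ℕ.* b ⟧ * (L + (x - y + z)) + ⟦ 3 ℕ.* c ⟧ * (L + y)
    ≡⟨ cong₂ (λ B C → ⟦ a ⟧ * (L + (z - x)) + B * (L + (x - y + z)) + C * (L + y))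
             (⟦⟧-homo-* 2 b) (⟦⟧-homo-* 3 c) ⟩
  ⟦ a ⟧ * (L + (z - x)) + ⟦ 2 ⟧ * ⟦ b ⟧ * (L + (x - y + z)) + ⟦ 3 ⟧ * ⟦ c ⟧ * (L + y)
    ≡⟨ regroup x y z L ⟦ a ⟧ ⟦ b ⟧ ⟦ c ⟧ ⟩
  (⟦ a ⟧ + ⟦ 2 ⟧ * ⟦ b ⟧ + ⟦ 3 ⟧ * ⟦ c ⟧) * L + linear (drift v) (a , b , c)
    ≡⟨ cong (λ S → S * L + linear (drift v) (a , b , c)) ⟦size⟧ ⟨
  ⟦ size (a , b , c) ⟧ * L + linear (drift v) (a , b , c) ∎
  where
  open ≡-Reasoning
  L = linear v (a , b , c)
  ⟦size⟧ : ⟦ size (a , b , c) ⟧ ≡ ⟦ a ⟧ + ⟦ 2 ⟧ * ⟦ b ⟧ + ⟦ 3 ⟧ * ⟦ c ⟧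
  ⟦size⟧ = begin
    ⟦ a ℕ.+ 2 ℕ.* b ℕ.+ 3 ℕ.* c ⟧         ≡⟨ ⟦⟧-homo-+ (a ℕ.+ 2 ℕ.* b) (3 ℕ.* c) ⟩
    ⟦ a ℕ.+ 2 ℕ.* b ⟧ + ⟦ 3 ℕ.* c ⟧       ≡⟨ cong₂ _+_ (⟦⟧-homo-+ a (2 ℕ.* b)) (⟦⟧-homo-* 3 c) ⟩
    ⟦ a ⟧ + ⟦ 2 ℕ.* b ⟧ + ⟦ 3 ⟧ * ⟦ c ⟧   ≡⟨ cong (λ B → ⟦ a ⟧ + B + ⟦ 3 ⟧ * ⟦ c ⟧) (⟦⟧-homo-* 2 b) ⟩
    ⟦ a ⟧ + ⟦ 2 ⟧ * ⟦ b ⟧ + ⟦ 3 ⟧ * ⟦ c ⟧ ∎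
  regroup : ∀ x y z L A B C →
    A * (L + (z - x)) + ⟦ 2 ⟧ * B * (L + (x - y + z)) + ⟦ 3 ⟧ * C * (L + y)
    ≡ (A + ⟦ 2 ⟧ * B + ⟦ 3 ⟧ * C) * L + ((z - x) * A + ⟦ 2 ⟧ * (x - y + z) * B + ⟦ 3 ⟧ * y * C)
  regroup = solve-∀ ℚ-ring
  small : ∀ a → ⟦ a ⟧ * linear v (a ∸ 1 , b , suc c) ≡ ⟦ a ⟧ * (linear v (a , b , c) + (z - x))
  small zero = 0*p≡0*q (linear v (0 , b , suc c)) (linear v (0 , b , c) + (z - x))
  small (suc a) rewrite ⟦⟧-suc a | ⟦⟧-suc c = cong ((1ℚ + ⟦ a ⟧) *_) (shift x y z ⟦ a ⟧ ⟦ b ⟧ ⟦ c ⟧)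
    where
    shift : ∀ x y z A B C → x * A + y * B + z * (1ℚ + C) ≡ x * (1ℚ + A) + y * B + z * C + (z - x)
    shift = solve-∀ ℚ-ring
  medium : ∀ b → ⟦ 2 ℕ.* b ⟧ * linear v (suc a , b ∸ 1 , suc c)
                 ≡ ⟦ 2 ℕ.* b ⟧ * (linear v (a , b , c) + (x - y + z))
  medium zero = 0*p≡0*q (linear v (suc a , 0 , suc c)) (linear v (a , 0 , c) + (x - y + z))
  medium (suc b) rewrite ⟦⟧-suc a | ⟦⟧-suc b | ⟦⟧-suc c =
    cong (⟦ 2 ℕ.* suc b ⟧ *_) (shift x y z ⟦ a ⟧ ⟦ b ⟧ ⟦ c ⟧)
    where
    shift : ∀ x y z A B C → x * (1ℚ + A) + y * B + z * (1ℚ + C) ≡ x * A + y * (1ℚ + B) + z * C + (x - y + z)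
    shift = solve-∀ ℚ-ring
  large : linear v (a , suc b , c) ≡ linear v (a , b , c) + y
  large rewrite ⟦⟧-suc b = shift x y z ⟦ a ⟧ ⟦ b ⟧ ⟦ c ⟧
    where
    shift : ∀ x y z A B C → x * A + y * (1ℚ + B) + z * C ≡ x * A + y * B + z * C + y
    shift = solve-∀ ℚ-ring

ψ₂ ψ₋₂ ψ₋₃ : ℚ³
ψ₂  = ⟦ 1 ⟧ , ⟦ 2 ⟧ , ⟦ 3 ⟧
ψ₋₂ = ⟦ 3 ⟧ , ⟦ 2 ⟧ , - ⟦ 3 ⟧
ψ₋₃ = ⟦ 1 ⟧ , ⟦ 2 ⟧ , - ⟦ 2 ⟧

drift-ψ₂ : drift ψ₂ ≡ ⟦ 2 ⟧ *ₗ ψ₂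
drift-ψ₂ = refl

drift-ψ₋₂ : drift ψ₋₂ ≡ (- ⟦ 2 ⟧) *ₗ ψ₋₂
drift-ψ₋₂ = refl

drift-ψ₋₃ : drift ψ₋₃ ≡ (- ⟦ 3 ⟧) *ₗ ψ₋₃
drift-ψ₋₃ = refl

𝟙 : ℚ³
𝟙 = 1ℚ , 1ℚ , 1ℚ

𝟙-decomposition : ∀ m →
  𝟙 · m ≡ (+ 9 ℚ./ 20) * (ψ₂ · m) + (+ 1 ℚ./ 4) * (ψ₋₂ · m) - (+ 1 ℚ./ 5) * (ψ₋₃ · m)
𝟙-decomposition (A , B , C) = lemma A B C
  where
  lemma : ∀ A B C → 1ℚ * A + 1ℚ * B + 1ℚ * C
    ≡ (+ 9 ℚ./ 20) * (⟦ 1 ⟧ * A + ⟦ 2 ⟧ * B + ⟦ 3 ⟧ * C)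
      + (+ 1 ℚ./ 4) * (⟦ 3 ⟧ * A + ⟦ 2 ⟧ * B + - ⟦ 3 ⟧ * C)
      - (+ 1 ℚ./ 5) * (⟦ 1 ⟧ * A + ⟦ 2 ⟧ * B + - ⟦ 2 ⟧ * C)
  lemma = solve-∀ ℚ-ring

expect : Dist → (Config → ℚ) → ℚ
expect D f = foldr (λ (p , cfg) acc → p * f cfg + acc) 0ℚ D

expect-++ : ∀ D E f → expect (D ++ E) f ≡ expect D f + expect E f
expect-++ [] E f = sym (ℚ.+-identityˡ (expect E f))
expect-++ ((p , cfg) ∷ D) E f = begin
  p * f cfg + expect (D ++ E) f              ≡⟨ cong (_+_ (p * f cfg)) (expect-++ D E f) ⟩
  p * f cfg + (expect D f + expect E f)      ≡⟨ ℚ.+-assoc (p * f cfg) (expect D f) (expect E f) ⟨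
  p * f cfg + expect D f + expect E f        ∎
  where open ≡-Reasoning

mean : Dist → ℚ³
mean D = expect D (λ (a , _ , _) → ⟦ a ⟧) , expect D (λ (_ , b , _) → ⟦ b ⟧) , expect D (λ (_ , _ , c) → ⟦ c ⟧)

expect-linear : ∀ v D → expect D (linear v) ≡ v · mean D
expect-linear (x , y , z) [] = sym (zeros x y z)
  where
  zeros : ∀ x y z → x * 0ℚ + y * 0ℚ + z * 0ℚ ≡ 0ℚ
  zeros = solve-∀ ℚ-ring
expect-linear v@(x , y , z) ((p , (a , b , c)) ∷ D) =
  trans (cong (_+_ (p * linear v (a , b , c))) (expect-linear v D)) (lemma p x y z ⟦ a ⟧ ⟦ b ⟧ ⟦ c ⟧ _ _ _)
  where
  lemma : ∀ p x y z A B C A′ B′ C′ →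
    p * (x * A + y * B + z * C) + (x * A′ + y * B′ + z * C′)
    ≡ x * (p * A + A′) + y * (p * B + B′) + z * (p * C + C′)
  lemma = solve-∀ ℚ-ring

expect-blocks : ∀ D → expect D (λ cfg → ⟦ blocks cfg ⟧) ≡ 𝟙 · mean D
expect-blocks [] = refl
expect-blocks ((p , (a , b , c)) ∷ D) = begin
  p * ⟦ a ℕ.+ b ℕ.+ c ⟧ + expect D (λ cfg → ⟦ blocks cfg ⟧)
    ≡⟨ cong₂ _+_ (cong (p *_) ⟦a+b+c⟧) (expect-blocks D) ⟩
  p * (⟦ a ⟧ + ⟦ b ⟧ + ⟦ c ⟧) + 𝟙 · mean D
    ≡⟨ regroup p ⟦ a ⟧ ⟦ b ⟧ ⟦ c ⟧ _ _ _ ⟩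
  𝟙 · mean ((p , (a , b , c)) ∷ D) ∎
  where
  open ≡-Reasoning
  ⟦a+b+c⟧ : ⟦ a ℕ.+ b ℕ.+ c ⟧ ≡ ⟦ a ⟧ + ⟦ b ⟧ + ⟦ c ⟧
  ⟦a+b+c⟧ = trans (⟦⟧-homo-+ (a ℕ.+ b) c) (cong (_+ ⟦ c ⟧) (⟦⟧-homo-+ a b))
  regroup : ∀ p A B C A′ B′ C′ → p * (A + B + C) + (1ℚ * A′ + 1ℚ * B′ + 1ℚ * C′)
    ≡ 1ℚ * (p * A + A′) + 1ℚ * (p * B + B′) + 1ℚ * (p * C + C′)
  regroup = solve-∀ ℚ-ring

-- Branches of probability zero stay in the distribution (among them the junk configurations
-- produced by the truncated `a ∸ 1` and `b ∸ 1`), so the size is only controlled on the others.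
Good : ℕ → ℚ × Config → Set
Good k (p , cfg) = p ≡ 0ℚ ⊎ size cfg ≡ 2 ℕ.* suc k

stepConfig-good : ∀ r k {x} → Good k x → All (Good (suc k)) (stepConfig r x)
stepConfig-good r k {_ , (a , b , c)} (inj₁ refl) =
  inj₁ (ℚ.*-zeroˡ (⟦ a ℕ.* h ⟧ ⊘ n)) ∷ inj₁ (ℚ.*-zeroˡ (⟦ b ℕ.* r ⟧ ⊘ n)) ∷
  inj₁ (ℚ.*-zeroˡ (⟦ c ℕ.* (3 ℕ.* h) ⟧ ⊘ n)) ∷ []
  where
  h = r ℕ./ 2
  n = ⟦ keys r (a , b , c) ⟧
stepConfig-good r k {p , (a , b , c)} (inj₂ size≡) =
  small a size≡ ∷ medium b size≡ ∷ inj₂ (grows (size-large a b c) size≡) ∷ []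
  where
  size-small : ∀ a b c → a ℕ.+ 2 ℕ.* b ℕ.+ 3 ℕ.* suc c ≡ 2 ℕ.+ (suc a ℕ.+ 2 ℕ.* b ℕ.+ 3 ℕ.* c)
  size-small = ℕ-Solver.solve-∀
  size-medium : ∀ a b c → suc a ℕ.+ 2 ℕ.* b ℕ.+ 3 ℕ.* suc c ≡ 2 ℕ.+ (a ℕ.+ 2 ℕ.* suc b ℕ.+ 3 ℕ.* c)
  size-medium = ℕ-Solver.solve-∀
  size-large : ∀ a b c → a ℕ.+ 2 ℕ.* suc b ℕ.+ 3 ℕ.* c ≡ 2 ℕ.+ (a ℕ.+ 2 ℕ.* b ℕ.+ 3 ℕ.* c)
  size-large = ℕ-Solver.solve-∀
  grows : ∀ {s s′} → s ≡ 2 ℕ.+ s′ → s′ ≡ 2 ℕ.* suc k → s ≡ 2 ℕ.* suc (suc k)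
  grows refl refl = sym (ℕ.*-suc 2 (suc k))
  small : ∀ a → size (a , b , c) ≡ 2 ℕ.* suc k →
          Good (suc k) (p * (⟦ a ℕ.* (r ℕ./ 2) ⟧ ⊘ ⟦ keys r (a , b , c) ⟧) , (a ∸ 1 , b , suc c))
  small zero    _     = inj₁ (trans (cong (p *_) (0⊘ ⟦ keys r (0 , b , c) ⟧)) (ℚ.*-zeroʳ p))
  small (suc a) size≡ = inj₂ (grows (size-small a b c) size≡)
  medium : ∀ b → size (a , b , c) ≡ 2 ℕ.* suc k →
           Good (suc k) (p * (⟦ b ℕ.* r ⟧ ⊘ ⟦ keys r (a , b , c) ⟧) , (suc a , b ∸ 1 , suc c))
  medium zero    _     = inj₁ (trans (cong (p *_) (0⊘ ⟦ keys r (a , 0 , c) ⟧)) (ℚ.*-zeroʳ p))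
  medium (suc b) size≡ = inj₂ (grows (size-medium a b c) size≡)

distAfter-good : ∀ r k → All (Good k) (distAfter r k)
distAfter-good r zero    = inj₂ refl ∷ []
distAfter-good r (suc k) = concat⁺ (map⁺ (All.map (stepConfig-good r k) (distAfter-good r k)))

module Process (r : ℕ) .{{_ : ℕ.NonZero r}} (2∣r : 2 ∣ r) where

  h : ℕ
  h = r ℕ./ 2

  H : ℚ
  H = ⟦ h ⟧

  r≡2h : r ≡ 2 ℕ.* h
  r≡2h = sym (ℕ.m*[n/m]≡n 2∣r)

  -- The probability that the batch is sent to one given block of size r/2.
  τ : ℕ → ℚ
  τ k = H ⊘ ⟦ keysAfter r k ⟧

  keysAfter-pos : ∀ k → 0ℚ < ⟦ keysAfter r k ⟧
  keysAfter-pos k = ⟦⟧-pos (suc k ℕ.* r) {{ℕ.m*n≢0 (suc k) r}}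

  τ-nonNeg : ∀ k → 0ℚ ≤ τ k
  τ-nonNeg k = ⊘-nonNeg (⟦⟧-nonNeg h) (keysAfter-pos k)

  keys-size : ∀ cfg → keys r cfg ≡ size cfg ℕ.* h
  keys-size (a , b , c) = trans (cong (λ s → a ℕ.* h ℕ.+ b ℕ.* s ℕ.+ c ℕ.* (3 ℕ.* h)) r≡2h) (lemma a b c h)
    where
    lemma : ∀ a b c h →
            a ℕ.* h ℕ.+ b ℕ.* (2 ℕ.* h) ℕ.+ c ℕ.* (3 ℕ.* h) ≡ (a ℕ.+ 2 ℕ.* b ℕ.+ 3 ℕ.* c) ℕ.* h
    lemma = ℕ-Solver.solve-∀

  keysAfter-size : ∀ k → keysAfter r k ≡ 2 ℕ.* suc k ℕ.* h
  keysAfter-size k = trans (cong (suc k ℕ.*_) r≡2h) (lemma (suc k) h)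
    where
    lemma : ∀ m h → m ℕ.* (2 ℕ.* h) ≡ 2 ℕ.* m ℕ.* h
    lemma = ℕ-Solver.solve-∀

  τ-inverse : ∀ k → ⟦ 2 ℕ.* suc k ⟧ * τ k ≡ 1ℚ
  τ-inverse k = begin
    ⟦ 2 ℕ.* suc k ⟧ * (H ⊘ n)    ≡⟨ *-⊘-assoc ⟦ 2 ℕ.* suc k ⟧ H n ⟨
    (⟦ 2 ℕ.* suc k ⟧ * H) ⊘ n    ≡⟨ cong (_⊘ n) (⟦⟧-homo-* (2 ℕ.* suc k) h) ⟨
    ⟦ 2 ℕ.* suc k ℕ.* h ⟧ ⊘ n    ≡⟨ cong (λ m → ⟦ m ⟧ ⊘ n) (keysAfter-size k) ⟨
    n ⊘ n                        ≡⟨ ⊘-self (≢-sym (ℚ.<⇒≢ (keysAfter-pos k))) ⟩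
    1ℚ                           ∎
    where
    open ≡-Reasoning
    n = ⟦ keysAfter r k ⟧

  branch-weight : ∀ {k} cfg s m → size cfg ≡ 2 ℕ.* suc k → m ≡ s ℕ.* h →
                  ⟦ m ⟧ ⊘ ⟦ keys r cfg ⟧ ≡ ⟦ s ⟧ * τ k
  branch-weight {k} cfg s m size≡ refl = begin
    ⟦ s ℕ.* h ⟧ ⊘ ⟦ keys r cfg ⟧       ≡⟨ cong (λ n → ⟦ s ℕ.* h ⟧ ⊘ ⟦ n ⟧) keys≡ ⟩
    ⟦ s ℕ.* h ⟧ ⊘ ⟦ keysAfter r k ⟧    ≡⟨ cong (_⊘ ⟦ keysAfter r k ⟧) (⟦⟧-homo-* s h) ⟩
    (⟦ s ⟧ * H) ⊘ ⟦ keysAfter r k ⟧    ≡⟨ *-⊘-assoc ⟦ s ⟧ H ⟦ keysAfter r k ⟧ ⟩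
    ⟦ s ⟧ * τ k                        ∎
    where
    open ≡-Reasoning
    keys≡ : keys r cfg ≡ keysAfter r k
    keys≡ = trans (keys-size cfg) (trans (cong (ℕ._* h) size≡) (sym (keysAfter-size k)))

  expect-branches : ∀ {k} v p a b c → size (a , b , c) ≡ 2 ℕ.* suc k →
    expect (stepConfig r (p , (a , b , c))) (linear v)
    ≡ p * (τ k * (⟦ a ⟧ * linear v (a ∸ 1 , b , suc c) + ⟦ 2 ℕ.* b ⟧ * linear v (suc a , b ∸ 1 , suc c)
                  + ⟦ 3 ℕ.* c ⟧ * linear v (a , suc b , c)))
  expect-branches {k} v p a b c size≡ = begin
    p * w₁ * L₁ + (p * w₂ * L₂ + (p * w₃ * L₃ + 0ℚ))
      ≡⟨ cong₂ _+_ (cong (λ w → p * w * L₁) (branch-weight cfg a _ size≡ refl))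
                   (cong₂ _+_ (cong (λ w → p * w * L₂) (branch-weight cfg (2 ℕ.* b) _ size≡ b*r≡2b*h))
                              (cong (λ w → p * w * L₃ + 0ℚ) (branch-weight cfg (3 ℕ.* c) _ size≡ (c*3h≡3c*h c h)))) ⟩
    p * (⟦ a ⟧ * τ k) * L₁ + (p * (⟦ 2 ℕ.* b ⟧ * τ k) * L₂ + (p * (⟦ 3 ℕ.* c ⟧ * τ k) * L₃ + 0ℚ))
      ≡⟨ factor p (τ k) ⟦ a ⟧ ⟦ 2 ℕ.* b ⟧ ⟦ 3 ℕ.* c ⟧ L₁ L₂ L₃ ⟩
    p * (τ k * (⟦ a ⟧ * L₁ + ⟦ 2 ℕ.* b ⟧ * L₂ + ⟦ 3 ℕ.* c ⟧ * L₃)) ∎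
    where
    open ≡-Reasoning
    cfg = a , b , c
    n = ⟦ keys r cfg ⟧
    w₁ = ⟦ a ℕ.* h ⟧ ⊘ n
    w₂ = ⟦ b ℕ.* r ⟧ ⊘ n
    w₃ = ⟦ c ℕ.* (3 ℕ.* h) ⟧ ⊘ n
    L₁ = linear v (a ∸ 1 , b , suc c)
    L₂ = linear v (suc a , b ∸ 1 , suc c)
    L₃ = linear v (a , suc b , c)
    b*2h≡2b*h : ∀ b h → b ℕ.* (2 ℕ.* h) ≡ 2 ℕ.* b ℕ.* h
    b*2h≡2b*h = ℕ-Solver.solve-∀
    b*r≡2b*h : b ℕ.* r ≡ 2 ℕ.* b ℕ.* h
    b*r≡2b*h = trans (cong (b ℕ.*_) r≡2h) (b*2h≡2b*h b h)
    c*3h≡3c*h : ∀ c h → c ℕ.* (3 ℕ.* h) ≡ 3 ℕ.* c ℕ.* h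
    c*3h≡3c*h = ℕ-Solver.solve-∀
    factor : ∀ p t A B C L₁ L₂ L₃ →
      p * (A * t) * L₁ + (p * (B * t) * L₂ + (p * (C * t) * L₃ + 0ℚ)) ≡ p * (t * (A * L₁ + B * L₂ + C * L₃))
    factor = solve-∀ ℚ-ring

  expect-stepConfig : ∀ {k} v {p} cfg → Good k (p , cfg) →
    expect (stepConfig r (p , cfg)) (linear v) ≡ p * (linear v cfg + τ k * linear (drift v) cfg)
  expect-stepConfig {k} v (a , b , c) (inj₁ refl) =
    no-mass (⟦ a ℕ.* h ⟧ ⊘ n) (linear v (a ∸ 1 , b , suc c))
            (⟦ b ℕ.* r ⟧ ⊘ n) (linear v (suc a , b ∸ 1 , suc c))
            (⟦ c ℕ.* (3 ℕ.* h) ⟧ ⊘ n) (linear v (a , suc b , c))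
            (linear v cfg + τ k * linear (drift v) cfg)
    where
    cfg = a , b , c
    n = ⟦ keys r cfg ⟧
    no-mass : ∀ w₁ L₁ w₂ L₂ w₃ L₃ L → 0ℚ * w₁ * L₁ + (0ℚ * w₂ * L₂ + (0ℚ * w₃ * L₃ + 0ℚ)) ≡ 0ℚ * L
    no-mass = solve-∀ ℚ-ring
  expect-stepConfig {k} v {p} cfg@(a , b , c) (inj₂ size≡) = begin
    expect (stepConfig r (p , cfg)) (linear v)    ≡⟨ expect-branches v p a b c size≡ ⟩
    p * (τ k * _)                                 ≡⟨ cong (λ t → p * (τ k * t)) (size-weighted-moves v a b c) ⟩
    p * (τ k * (⟦ size cfg ⟧ * L + Δ))            ≡⟨ distribute p (τ k) ⟦ size cfg ⟧ L Δ ⟩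
    p * (⟦ size cfg ⟧ * τ k * L + τ k * Δ)        ≡⟨ cong (λ s → p * (⟦ s ⟧ * τ k * L + τ k * Δ)) size≡ ⟩
    p * (⟦ 2 ℕ.* suc k ⟧ * τ k * L + τ k * Δ)     ≡⟨ cong (λ t → p * (t * L + τ k * Δ)) (τ-inverse k) ⟩
    p * (1ℚ * L + τ k * Δ)                        ≡⟨ cong (λ t → p * (t + τ k * Δ)) (ℚ.*-identityˡ L) ⟩
    p * (L + τ k * Δ)                             ∎
    where
    open ≡-Reasoning
    L = linear v cfg
    Δ = linear (drift v) cfg
    distribute : ∀ p t S L Δ → p * (t * (S * L + Δ)) ≡ p * (S * t * L + t * Δ)
    distribute = solve-∀ ℚ-ring

  expect-step : ∀ {k} v D → All (Good k) D →
    expect (step r D) (linear v) ≡ expect D (linear v) + τ k * expect D (linear (drift v))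
  expect-step {k} v [] [] = sym (trans (ℚ.+-identityˡ (τ k * 0ℚ)) (ℚ.*-zeroʳ (τ k)))
  expect-step {k} v ((p , cfg) ∷ D) (good ∷ goods) = begin
    expect (stepConfig r (p , cfg) ++ step r D) (linear v)
      ≡⟨ expect-++ (stepConfig r (p , cfg)) (step r D) (linear v) ⟩
    expect (stepConfig r (p , cfg)) (linear v) + expect (step r D) (linear v)
      ≡⟨ cong₂ _+_ (expect-stepConfig v cfg good) (expect-step v D goods) ⟩
    p * (linear v cfg + τ k * linear (drift v) cfg) + (expect D (linear v) + τ k * expect D (linear (drift v)))
      ≡⟨ regroup p (τ k) (linear v cfg) (linear (drift v) cfg) (expect D (linear v)) (expect D (linear (drift v))) ⟩
    p * linear v cfg + expect D (linear v) + τ k * (p * linear (drift v) cfg + expect D (linear (drift v))) ∎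
    where
    open ≡-Reasoning
    regroup : ∀ p t L Δ E F → p * (L + t * Δ) + (E + t * F) ≡ p * L + E + t * (p * Δ + F)
    regroup = solve-∀ ℚ-ring

  μ : ℕ → ℚ³
  μ k = mean (distAfter r k)

  mean-step : ∀ v k → v · μ (suc k) ≡ v · μ k + τ k * (drift v · μ k)
  mean-step v k = begin
    v · μ (suc k)                                            ≡⟨ expect-linear v (distAfter r (suc k)) ⟨
    expect (step r D) (linear v)                             ≡⟨ expect-step v D (distAfter-good r k) ⟩
    expect D (linear v) + τ k * expect D (linear (drift v))
      ≡⟨ cong₂ (λ E F → E + τ k * F) (expect-linear v D) (expect-linear (drift v) D) ⟩
    v · μ k + τ k * (drift v · μ k)                          ∎
    where
    open ≡-Reasoning
    D = distAfter r k

  mean-eigen : ∀ v e k → drift v ≡ e *ₗ v → v · μ (suc k) ≡ (1ℚ + e * τ k) * (v · μ k)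
  mean-eigen v e k eigen = begin
    v · μ (suc k)                       ≡⟨ mean-step v k ⟩
    v · μ k + τ k * (drift v · μ k)     ≡⟨ cong (λ w → v · μ k + τ k * (w · μ k)) eigen ⟩
    v · μ k + τ k * ((e *ₗ v) · μ k)    ≡⟨ cong (λ m → v · μ k + τ k * m) (*ₗ-· e v (μ k)) ⟩
    v · μ k + τ k * (e * (v · μ k))     ≡⟨ regroup (v · μ k) (τ k) e ⟩
    (1ℚ + e * τ k) * (v · μ k)          ∎
    where
    open ≡-Reasoning
    regroup : ∀ m t e → m + t * (e * m) ≡ (1ℚ + e * t) * m
    regroup = solve-∀ ℚ-ring

  mean-ψ₂ : ∀ k → ψ₂ · μ k ≡ ⟦ 2 ℕ.* suc k ⟧
  mean-ψ₂ zero    = refl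
  mean-ψ₂ (suc k) = begin
    ψ₂ · μ (suc k)                    ≡⟨ mean-eigen ψ₂ ⟦ 2 ⟧ k drift-ψ₂ ⟩
    (1ℚ + ⟦ 2 ⟧ * τ k) * (ψ₂ · μ k)   ≡⟨ cong ((1ℚ + ⟦ 2 ⟧ * τ k) *_) (mean-ψ₂ k) ⟩
    (1ℚ + ⟦ 2 ⟧ * τ k) * S            ≡⟨ expand S (τ k) ⟩
    S + ⟦ 2 ⟧ * (S * τ k)             ≡⟨ cong (λ t → S + ⟦ 2 ⟧ * t) (τ-inverse k) ⟩
    S + ⟦ 2 ⟧ * 1ℚ                    ≡⟨ ⟦⟧-homo-+ (2 ℕ.* suc k) 2 ⟨
    ⟦ 2 ℕ.* suc k ℕ.+ 2 ⟧             ≡⟨ cong ⟦_⟧ (trans (ℕ.+-comm (2 ℕ.* suc k) 2) (sym (ℕ.*-suc 2 (suc k)))) ⟩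
    ⟦ 2 ℕ.* suc (suc k) ⟧             ∎
    where
    open ≡-Reasoning
    S = ⟦ 2 ℕ.* suc k ⟧
    expand : ∀ S t → (1ℚ + ⟦ 2 ⟧ * t) * S ≡ S + ⟦ 2 ⟧ * (S * t)
    expand = solve-∀ ℚ-ring

  -- ⟦ 2 ⟧ is the value of ψ₋₂ and ψ₋₃ on the initial configuration (0 , 1 , 0).
  first-batch : ∀ e → (1ℚ + e * τ 0) * ⟦ 2 ⟧ ≡ ⟦ 2 ⟧ + e
  first-batch e = begin
    (1ℚ + e * τ 0) * ⟦ 2 ⟧     ≡⟨ expand e (τ 0) ⟩
    ⟦ 2 ⟧ + e * (⟦ 2 ⟧ * τ 0)  ≡⟨ cong (λ t → ⟦ 2 ⟧ + e * t) (τ-inverse 0) ⟩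
    ⟦ 2 ⟧ + e * 1ℚ             ≡⟨ cong (_+_ ⟦ 2 ⟧) (ℚ.*-identityʳ e) ⟩
    ⟦ 2 ⟧ + e                  ∎
    where
    open ≡-Reasoning
    expand : ∀ e t → (1ℚ + e * t) * ⟦ 2 ⟧ ≡ ⟦ 2 ⟧ + e * (⟦ 2 ⟧ * t)
    expand = solve-∀ ℚ-ring

  mean-ψ₋₂ : ∀ k → ψ₋₂ · μ (suc k) ≡ 0ℚ
  mean-ψ₋₂ zero    = trans (mean-eigen ψ₋₂ (- ⟦ 2 ⟧) 0 drift-ψ₋₂) (first-batch (- ⟦ 2 ⟧))
  mean-ψ₋₂ (suc k) = begin
    ψ₋₂ · μ (suc (suc k))     ≡⟨ mean-eigen ψ₋₂ (- ⟦ 2 ⟧) (suc k) drift-ψ₋₂ ⟩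
    f * (ψ₋₂ · μ (suc k))     ≡⟨ cong (f *_) (mean-ψ₋₂ k) ⟩
    f * 0ℚ                    ≡⟨ ℚ.*-zeroʳ f ⟩
    0ℚ                        ∎
    where
    open ≡-Reasoning
    f = 1ℚ + (- ⟦ 2 ⟧) * τ (suc k)

  g : ℕ → ℚ
  g k = - (ψ₋₃ · μ (suc k))

  decay : ℕ → ℚ
  decay k = 1ℚ + (- ⟦ 3 ⟧) * τ (suc k)

  g-step : ∀ k → g (suc k) ≡ decay k * g k
  g-step k = trans (cong -_ (mean-eigen ψ₋₃ (- ⟦ 3 ⟧) (suc k) drift-ψ₋₃))
                   (ℚ.neg-distribʳ-* (decay k) (ψ₋₃ · μ (suc k)))

  decay-unitInterval : ∀ k → InUnitInterval (decay k)
  decay-unitInterval k =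
    subst (0ℚ ≤_) (sym decay≡) (*-nonNeg (⟦⟧-nonNeg (suc (2 ℕ.* k))) (τ-nonNeg (suc k))) ,
    subst (0ℚ ≤_) (sym (1-decay (τ (suc k)))) (*-nonNeg (⟦⟧-nonNeg 3) (τ-nonNeg (suc k)))
    where
    open ≡-Reasoning
    t = τ (suc k)
    1-decay : ∀ t → 1ℚ - (1ℚ + (- ⟦ 3 ⟧) * t) ≡ ⟦ 3 ⟧ * t
    1-decay = solve-∀ ℚ-ring
    cancel : ∀ S t → (⟦ 3 ⟧ + S) * t + (- ⟦ 3 ⟧) * t ≡ S * t
    cancel = solve-∀ ℚ-ring
    2[k+2]≡3+[2k+1] : ∀ k → 2 ℕ.* suc (suc k) ≡ 3 ℕ.+ suc (2 ℕ.* k)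
    2[k+2]≡3+[2k+1] = ℕ-Solver.solve-∀
    decay≡ : decay k ≡ ⟦ suc (2 ℕ.* k) ⟧ * t
    decay≡ = begin
      1ℚ + (- ⟦ 3 ⟧) * t
        ≡⟨ cong (_+ (- ⟦ 3 ⟧) * t) (τ-inverse (suc k)) ⟨
      ⟦ 2 ℕ.* suc (suc k) ⟧ * t + (- ⟦ 3 ⟧) * t
        ≡⟨ cong (λ s → ⟦ s ⟧ * t + (- ⟦ 3 ⟧) * t) (2[k+2]≡3+[2k+1] k) ⟩
      ⟦ 3 ℕ.+ suc (2 ℕ.* k) ⟧ * t + (- ⟦ 3 ⟧) * t
        ≡⟨ cong (λ s → s * t + (- ⟦ 3 ⟧) * t) (⟦⟧-homo-+ 3 (suc (2 ℕ.* k))) ⟩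
      (⟦ 3 ⟧ + ⟦ suc (2 ℕ.* k) ⟧) * t + (- ⟦ 3 ⟧) * t
        ≡⟨ cancel ⟦ suc (2 ℕ.* k) ⟧ t ⟩
      ⟦ suc (2 ℕ.* k) ⟧ * t ∎

  g-unitInterval : ∀ k → InUnitInterval (g k)
  g-unitInterval zero    = subst InUnitInterval (sym g0≡1) (ℚ.nonNegative⁻¹ 1ℚ , ℚ.≤-refl)
    where
    g0≡1 : g 0 ≡ 1ℚ
    g0≡1 = cong -_ (trans (mean-eigen ψ₋₃ (- ⟦ 3 ⟧) 0 drift-ψ₋₃) (first-batch (- ⟦ 3 ⟧)))
  g-unitInterval (suc k) = subst InUnitInterval (sym (g-step k)) (*-unitInterval (decay-unitInterval k) (g-unitInterval k))

  expectedBlocks-formula : ∀ k → expectedBlocks r (suc k) ≡ (+ 9 ℚ./ 10) * ⟦ suc (suc k) ⟧ + (+ 1 ℚ./ 5) * g k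
  expectedBlocks-formula k = begin
    expectedBlocks r (suc k)
      ≡⟨ expect-blocks (distAfter r (suc k)) ⟩
    𝟙 · μ (suc k)
      ≡⟨ 𝟙-decomposition (μ (suc k)) ⟩
    (+ 9 ℚ./ 20) * (ψ₂ · μ (suc k)) + (+ 1 ℚ./ 4) * (ψ₋₂ · μ (suc k)) - (+ 1 ℚ./ 5) * E
      ≡⟨ cong₂ (λ A B → (+ 9 ℚ./ 20) * A + (+ 1 ℚ./ 4) * B - (+ 1 ℚ./ 5) * E) (mean-ψ₂ (suc k)) (mean-ψ₋₂ k) ⟩
    (+ 9 ℚ./ 20) * ⟦ 2 ℕ.* M ⟧ + (+ 1 ℚ./ 4) * 0ℚ - (+ 1 ℚ./ 5) * E
      ≡⟨ cong (λ A → (+ 9 ℚ./ 20) * A + (+ 1 ℚ./ 4) * 0ℚ - (+ 1 ℚ./ 5) * E) (⟦⟧-homo-* 2 M) ⟩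
    (+ 9 ℚ./ 20) * (⟦ 2 ⟧ * ⟦ M ⟧) + (+ 1 ℚ./ 4) * 0ℚ - (+ 1 ℚ./ 5) * E
      ≡⟨ simplify ⟦ M ⟧ E ⟩
    (+ 9 ℚ./ 10) * ⟦ M ⟧ + (+ 1 ℚ./ 5) * g k ∎
    where
    open ≡-Reasoning
    M = suc (suc k)
    E = ψ₋₃ · μ (suc k)
    simplify : ∀ m E → (+ 9 ℚ./ 20) * (⟦ 2 ⟧ * m) + (+ 1 ℚ./ 4) * 0ℚ - (+ 1 ℚ./ 5) * E
                       ≡ (+ 9 ℚ./ 10) * m + (+ 1 ℚ./ 5) * (- E)
    simplify = solve-∀ ℚ-ring

  ratio-bound : ∀ k → ∣ ⟦ keysAfter r (suc k) ⟧ ⊘ expectedBlocks r (suc k) - (+ 10 ℚ./ 9) * ⟦ r ⟧ ∣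
                        * ⟦ suc (suc k) ⟧ ≤ ⟦ r ⟧
  ratio-bound k =
    subst (λ n → ∣ n ⊘ expectedBlocks r (suc k) - (+ 10 ℚ./ 9) * ⟦ r ⟧ ∣ * ⟦ suc (suc k) ⟧ ≤ ⟦ r ⟧)
          (sym (⟦⟧-homo-* (suc (suc k)) r))
          (ratio-error (⟦⟧-pos (suc (suc k))) (⟦⟧-nonNeg r) (g-unitInterval k) (expectedBlocks-formula k))

mainTheorem3 :
    (B r : ℕ) → 0 ℕ.< B → 0 ℕ.< r → 2 ∣ r →
    B ℕ.< ℕ._*_ 2 r → ℕ._*_ 3 r ℕ.≤ ℕ._*_ 2 B →
    (ε : ℚ) → 0ℚ ℚ.< ε →
    Σ ℕ (λ N → (k : ℕ) → N ℕ.≤ k →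
      ∣ (⟦ keysAfter r k ⟧ ⊘ expectedBlocks r k) ℚ.- ((+ 10) ℚ./ 9) ℚ.* ⟦ r ⟧ ∣ ℚ.< ε)
mainTheorem3 _ r _ 0<r 2∣r _ _ ε 0<ε with archimedean r ε 0<ε
... | N , r<ε*m = suc N , close
  where
  -- The constraints on B only make TargetSplit produce the block sizes built into stepConfig.
  open Process r {{ℕ.>-nonZero 0<r}} 2∣r
  close : ∀ k → suc N ℕ.≤ k → ∣ (⟦ keysAfter r k ⟧ ⊘ expectedBlocks r k) - (+ 10 ℚ./ 9) * ⟦ r ⟧ ∣ < ε
  close (suc k) (ℕ.s≤s N≤k) =
    ℚ.*-cancelʳ-<-nonNeg ⟦ suc (suc k) ⟧ {{ℚ.nonNegative (⟦⟧-nonNeg (suc (suc k)))}}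
      (ℚ.≤-<-trans (ratio-bound k) (r<ε*m (ℕ.s≤s (ℕ.m≤n⇒m≤1+n N≤k))))
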